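{- Let $a,b,c$ be three distinct agents in $A$ and let $\varphi=p_a\wedge K_bp_c$ with $p_a\in P_a$, $p_c\in P_c$. There is no formula $\varphi^{\not\bowtie}\in\mathcal L^+$ such that for all pointed simplicial models $(\mathcal C,X)$: $$\mathcal C,X\not\bowtie\varphi\iff\mathcal C,X\vDash\varphi^{\not\bowtie}.$$
   Context: Let $A$ be a finite set of agents and $P=A\sqcup\bigsqcup_{a\in A}P_a$, where the $P_a$ are countable, pairwise disjoint sets of local atoms for agent $a$ (disjoint from $A$); each $a\in A$ is also a global atom. $\mathcal L^+$: $\varphi::=a\mid p_a\mid\neg\varphi\mid(\varphi\wedge\varphi)\mid\widehat K_a\varphi$ ($a\in A$, $p_a\in P_a$); $K_a\varphi:=\neg\widehat K_a\neg\varphi$. A simplicial model $\mathcal C=(C,\chi,\ell)$: $C$ a nonempty set of nonempty finite subsets (simplexes) of a vertex set $\mathcal V$, closed under nonempty subsets and containing all singletons; $\chi:\mathcal V\to A$ injective on each simplex; $\ell:\mathcal V\to 2^{P\setminus A}$ with $\ell(v)\subseteq P_{\chi(v)}$. $\chi(X)=\{\chi(v)\mid v\in X\}$, $\ell(X)=\bigcup_{v\in X}\ell(v)$. Facets are maximal simplexes, $\mathcal F(C)$ the set of facets; a pointed model is $(\mathcal C,X)$ with $X\in\mathcal F(C)$. Semantics at a facet $X$: $\mathcal C,X\bowtie a$ always; $\mathcal C,X\bowtie p_a$ iff $a\in\chi(X)$; $\neg\varphi$ defined iff $\varphi$ is; $\varphi\wedge\psi$ defined iff both are; $\mathcal C,X\bowtie\widehat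 K_a\varphi$ iff $\mathcal C,Y\bowtie\varphi$ for some $Y\in\mathcal F(C)$ with $a\in\chi(X\cap Y)$. $\mathcal C,X\vDash a$ iff $a\in\chi(X)$; $\mathcal C,X\vDash p_a$ iff $p_a\in\ell(X)$; $\mathcal C,X\vDash\neg\varphi$ iff $\mathcal C,X\bowtie\varphi$ and $\mathcal C,X\nvDash\varphi$; conjunction as usual; $\mathcal C,X\vDash\widehat K_a\varphi$ iff $\mathcal C,Y\vDash\varphi$ for some $Y\in\mathcal F(C)$ with $a\in\chi(X\cap Y)$. -}

module Defs where

open import Data.Nat using (ℕ)
open import Data.Fin using (Fin)
open import Data.List using (List; []; _∷_)
open import Data.List.Membership.Propositional using (_∈_)
open import Data.List.Relation.Binary.Subset.Propositional using (_⊆_)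
open import Data.Product using (Σ; _×_; ∃; ∃-syntax)
open import Data.Unit using (⊤)
open import Relation.Nullary using (¬_)
open import Relation.Binary.PropositionalEquality using (_≡_; _≢_)
open import Function.Definitions using (Injective)

-- Agents: A = Fin n.  Local atoms of agent a: elements of L a.
-- The global atom set P = A ⊔ ⨆_a P_a is encoded by tagging:
-- a local atom is a pair (a , p) with p : L a, so the P_a are
-- automatically pairwise disjoint and disjoint from A.

Countable : Set → Set
Countable S = Σ (S → ℕ) λ f → Injective _≡_ _≡_ f

data Form {n : ℕ} (L : Fin n → Set) : Set where
  agent : Fin n → Form L
  atom  : (a : Fin n) → L a → Form L
  neg   : Form L → Form L
  and   : Form L → Form L → Form L
  Khat  : Fin n → Form L → Form L

K : ∀ {n} {L : Fin n → Set} → Fin n → Form L → Form L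
K a φ = neg (Khat a (neg φ))

-- Simplicial models.  Simplexes are finite subsets of V, represented as
-- lists (read as sets via membership).
record Model {n : ℕ} (L : Fin n → Set) : Set₁ where
  field
    V        : Set
    Simplex  : List V → Set
    simplex-nonempty : ∀ X → Simplex X → X ≢ []
    someSimplex : Σ (List V) Simplex
    -- closed under nonempty subsets (hence also invariant under
    -- reordering/duplication of the list representation)
    downClosed : ∀ X Y → Simplex X → Y ⊆ X → Y ≢ [] → Simplex Y
    singletons : ∀ v → Simplex (v ∷ [])
    χ        : V → Fin n
    χ-inj    : ∀ X → Simplex X → ∀ {v w} → v ∈ X → w ∈ X → χ v ≡ χ w → v ≡ w
    -- labelling ℓ(v) ⊆ P_{χ(v)}: lab v a p means (a , p) ∈ ℓ(v)
    lab      : V → (a : Fin n) → L a → Set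
    lab-local : ∀ v a p → lab v a p → χ v ≡ a

module _ {n : ℕ} {L : Fin n → Set} (M : Model L) where
  open Model M

  Facet : List V → Set
  Facet X = Simplex X × (∀ Y → Simplex Y → X ⊆ Y → Y ⊆ X)

  _∈χ_ : Fin n → List V → Set
  a ∈χ X = ∃[ v ] (v ∈ X × χ v ≡ a)

  _∈χ∩_,_ : Fin n → List V → List V → Set
  a ∈χ∩ X , Y = ∃[ v ] (v ∈ X × v ∈ Y × χ v ≡ a)

  InLab : (a : Fin n) → L a → List V → Set
  InLab a p X = ∃[ v ] (v ∈ X × lab v a p)

  Def : List V → Form L → Set
  Def X (agent a)  = ⊤
  Def X (atom a p) = a ∈χ X
  Def X (neg φ)    = Def X φ
  Def X (and φ ψ)  = Def X φ × Def X ψ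
  Def X (Khat a φ) = ∃[ Y ] (Facet Y × a ∈χ∩ X , Y × Def Y φ)

  Sat : List V → Form L → Set
  Sat X (agent a)  = a ∈χ X
  Sat X (atom a p) = InLab a p X
  Sat X (neg φ)    = Def X φ × ¬ Sat X φ
  Sat X (and φ ψ)  = Sat X φ × Sat X ψ
  Sat X (Khat a φ) = ∃[ Y ] (Facet Y × a ∈χ∩ X , Y × Sat Y φ)

{-# OPTIONS --safe #-}
-- ψ must be true on the one-vertex model coloured a, where φ is undefined, so ψ is
-- defined there; this forces every modality of ψ to be K̂_a.  Such formulas cannot
-- tell the single edge {a,b}, where φ is undefined because p_c never is, from the
-- facet {a,b} of the path {a,b}–{b,c}, where φ is defined: the two are bisimilar
-- for agent a, since in both the only facet a can see is the facet itself.
module Submission where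

open import Defs
open import Data.Nat using (ℕ)
open import Data.Fin using (Fin)
open import Data.List using (List; []; _∷_)
open import Data.List.Membership.Propositional using (_∈_)
open import Data.List.Relation.Unary.Any using (here; there)
open import Data.List.Relation.Unary.Any.Properties using (¬Any[])
open import Data.Product using (Σ; _×_; _,_; proj₁; proj₂; ∃-syntax)
open import Data.Product.Function.NonDependent.Propositional using (_×-⇔_)
open import Data.Unit using (⊤; tt)
open import Data.Empty using (⊥; ⊥-elim)
open import Function.Bundles using (_⇔_; mk⇔; Equivalence)
open import Function.Construct.Identity using (⇔-id)
open import Function.Related.TypeIsomorphisms using (¬-cong-⇔)
open import Relation.Nullary using (¬_)
open import Relation.Binary.PropositionalEquality using (_≡_; _≢_; refl; sym; trans; subst)

module _ {n : ℕ} {L : Fin n → Set} where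

  sat⇒def : (M : Model L) (X : List (Model.V M)) (θ : Form L) → Sat M X θ → Def M X θ
  sat⇒def M X (agent x)  _                = tt
  sat⇒def M X (atom x p) (v , v∈X , ℓv)   = v , v∈X , Model.lab-local M v x p ℓv
  sat⇒def M X (neg θ)    (dθ , _)         = dθ
  sat⇒def M X (and θ η)  (sθ , sη)        = sat⇒def M X θ sθ , sat⇒def M X η sη
  sat⇒def M X (Khat x θ) (Y , fY , x∈ , sθ) = Y , fY , x∈ , sat⇒def M Y θ sθ

  OnlyKhat : Fin n → Form L → Set
  OnlyKhat a (agent _)  = ⊤
  OnlyKhat a (atom _ _) = ⊤
  OnlyKhat a (neg θ)    = OnlyKhat a θ
  OnlyKhat a (and θ η)  = OnlyKhat a θ × OnlyKhat a η
  OnlyKhat a (Khat x θ) = x ≡ a × OnlyKhat a θ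

  def⇒onlyKhat : (M : Model L) {a : Fin n} → (∀ v → Model.χ M v ≡ a) →
                 ∀ X θ → Def M X θ → OnlyKhat a θ
  def⇒onlyKhat M χ≡a X (agent _)  _         = tt
  def⇒onlyKhat M χ≡a X (atom _ _) _         = tt
  def⇒onlyKhat M χ≡a X (neg θ)    dθ        = def⇒onlyKhat M χ≡a X θ dθ
  def⇒onlyKhat M χ≡a X (and θ η)  (dθ , dη) = def⇒onlyKhat M χ≡a X θ dθ , def⇒onlyKhat M χ≡a X η dη
  def⇒onlyKhat M χ≡a X (Khat x θ) (Y , _ , (v , _ , _ , χv≡x) , dθ) =
    trans (sym χv≡x) (χ≡a v) , def⇒onlyKhat M χ≡a Y θ dθ

  Possibly : (M : Model L) → Fin n → List (Model.V M) → (List (Model.V M) → Set) → Set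
  Possibly M a X P = ∃[ Y ] (Facet M Y × _∈χ∩_,_ M a X Y × P Y)

  record Bisimulation (a : Fin n) (M N : Model L) : Set₁ where
    field
      _∼_     : List (Model.V M) → List (Model.V N) → Set
      colours : ∀ {Z W} → Z ∼ W → ∀ x → _∈χ_ M x Z ⇔ _∈χ_ N x W
      labels  : ∀ {Z W} → Z ∼ W → ∀ x p → InLab M x p Z ⇔ InLab N x p W
      forth   : ∀ {Z W Y} → Z ∼ W → Facet M Y → _∈χ∩_,_ M a Z Y → Possibly N a W (Y ∼_)
      back    : ∀ {Z W Y′} → Z ∼ W → Facet N Y′ → _∈χ∩_,_ N a W Y′ → Possibly M a Z (_∼ Y′)

  module _ {a : Fin n} {M N : Model L} (B : Bisimulation a M N) where
    open Bisimulation B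

    Khat-invariant : {P : List (Model.V M) → Set} {Q : List (Model.V N) → Set} →
                     (∀ {Y Y′} → Y ∼ Y′ → P Y ⇔ Q Y′) →
                     ∀ {Z W} → Z ∼ W → Possibly M a Z P ⇔ Possibly N a W Q
    Khat-invariant {P} {Q} P⇔Q {Z} {W} Z∼W = mk⇔ to from
      where
      to : Possibly M a Z P → Possibly N a W Q
      to (Y , fY , a∈ , pY) with forth Z∼W fY a∈
      ... | Y′ , fY′ , a∈′ , Y∼Y′ = Y′ , fY′ , a∈′ , Equivalence.to (P⇔Q Y∼Y′) pY
      from : Possibly N a W Q → Possibly M a Z P
      from (Y′ , fY′ , a∈′ , qY′) with back Z∼W fY′ a∈′
      ... | Y , fY , a∈ , Y∼Y′ = Y , fY , a∈ , Equivalence.from (P⇔Q Y∼Y′) qY′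

    def-invariant : ∀ θ → OnlyKhat a θ → ∀ {Z W} → Z ∼ W → Def M Z θ ⇔ Def N W θ
    def-invariant (agent _)   _          _   = ⇔-id ⊤
    def-invariant (atom x _)  _          Z∼W = colours Z∼W x
    def-invariant (neg θ)     oθ         Z∼W = def-invariant θ oθ Z∼W
    def-invariant (and θ η)   (oθ , oη)  Z∼W = def-invariant θ oθ Z∼W ×-⇔ def-invariant η oη Z∼W
    def-invariant (Khat x θ)  (refl , oθ) Z∼W = Khat-invariant (def-invariant θ oθ) Z∼W

    sat-invariant : ∀ θ → OnlyKhat a θ → ∀ {Z W} → Z ∼ W → Sat M Z θ ⇔ Sat N W θ
    sat-invariant (agent x)   _          Z∼W = colours Z∼W x
    sat-invariant (atom x p)  _          Z∼W = labels Z∼W x p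
    sat-invariant (neg θ)     oθ         Z∼W =
      def-invariant θ oθ Z∼W ×-⇔ ¬-cong-⇔ (sat-invariant θ oθ Z∼W)
    sat-invariant (and θ η)   (oθ , oη)  Z∼W = sat-invariant θ oθ Z∼W ×-⇔ sat-invariant η oη Z∼W
    sat-invariant (Khat x θ)  (refl , oθ) Z∼W = Khat-invariant (sat-invariant θ oθ) Z∼W

  module FullSimplex (V : Set) (χ : V → Fin n) (χ-injective : ∀ {v w} → χ v ≡ χ w → v ≡ w)
                     (v₀ : V) where

    model : Model L
    model = record
      { V = V ; Simplex = λ X → X ≢ [] ; simplex-nonempty = λ _ X≢[] → X≢[]
      ; someSimplex = v₀ ∷ [] , λ () ; downClosed = λ _ _ _ _ Y≢[] → Y≢[]
      ; singletons = λ _ () ; χ = χ ; χ-inj = λ _ _ _ _ → χ-injective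
      ; lab = λ _ _ _ → ⊥ ; lab-local = λ _ _ _ () }

    complete⇒facet : ∀ {X} → (∀ v → v ∈ X) → Facet model X
    complete⇒facet ∈X = (λ X≡[] → ¬Any[] (subst (v₀ ∈_) X≡[] (∈X v₀))) , λ _ _ _ {v} _ → ∈X v

    facet⇒complete : ∀ {X} → Facet model X → ∀ v → v ∈ X
    facet⇒complete {X} (_ , maximal) v = maximal (v ∷ X) (λ ()) there (here refl)

module Counterexample {n : ℕ} {L : Fin n → Set} {a b c : Fin n}
                      (a≢b : a ≢ b) (a≢c : a ≢ c) (b≢c : b ≢ c) where

  module Point = FullSimplex {L = L} ⊤ (λ _ → a) (λ _ → refl) tt

  point : Model L
  point = Point.model

  point-facet : Facet point (tt ∷ [])
  point-facet = Point.complete⇒facet λ _ → here refl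

  point-lacks-b : ∀ {θ X} → ¬ Def point X (K b θ)
  point-lacks-b (_ , _ , (_ , _ , _ , a≡b) , _) = a≢b a≡b

  data EdgeVertex : Set where
    left middle : EdgeVertex

  edge-colour : EdgeVertex → Fin n
  edge-colour left   = a
  edge-colour middle = b

  edge-colour-injective : ∀ {v w} → edge-colour v ≡ edge-colour w → v ≡ w
  edge-colour-injective {left}   {left}   _   = refl
  edge-colour-injective {left}   {middle} a≡b = ⊥-elim (a≢b a≡b)
  edge-colour-injective {middle} {left}   b≡a = ⊥-elim (a≢b (sym b≡a))
  edge-colour-injective {middle} {middle} _   = refl

  module Edge = FullSimplex {L = L} EdgeVertex edge-colour edge-colour-injective left

  edge : Model L
  edge = Edge.model

  edge-facet : Facet edge (left ∷ middle ∷ [])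
  edge-facet = Edge.complete⇒facet λ where
    left   → here refl
    middle → there (here refl)

  edge-lacks-c : ∀ {X} → ¬ _∈χ_ edge c X
  edge-lacks-c (left   , _ , a≡c) = a≢c a≡c
  edge-lacks-c (middle , _ , b≡c) = b≢c b≡c

  data PathVertex : Set where
    left middle right : PathVertex

  path-colour : PathVertex → Fin n
  path-colour left   = a
  path-colour middle = b
  path-colour right  = c

  path-colour-injective : ∀ {v w} → path-colour v ≡ path-colour w → v ≡ w
  path-colour-injective {left}   {left}   _   = refl
  path-colour-injective {left}   {middle} a≡b = ⊥-elim (a≢b a≡b)
  path-colour-injective {left}   {right}  a≡c = ⊥-elim (a≢c a≡c)
  path-colour-injective {middle} {left}   b≡a = ⊥-elim (a≢b (sym b≡a))
  path-colour-injective {middle} {middle} _   = refl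
  path-colour-injective {middle} {right}  b≡c = ⊥-elim (b≢c b≡c)
  path-colour-injective {right}  {left}   c≡a = ⊥-elim (a≢c (sym c≡a))
  path-colour-injective {right}  {middle} c≡b = ⊥-elim (b≢c (sym c≡b))
  path-colour-injective {right}  {right}  _   = refl

  PathSimplex : List PathVertex → Set
  PathSimplex X = X ≢ [] × ¬ (left ∈ X × right ∈ X)

  path-singleton : ∀ v → PathSimplex (v ∷ [])
  path-singleton v = (λ ()) , λ where
    (here refl , here ())
    (_ , there ())
    (there () , _)

  path : Model L
  path = record
    { V = PathVertex ; Simplex = PathSimplex ; simplex-nonempty = λ _ → proj₁
    ; someSimplex = left ∷ [] , path-singleton left
    ; downClosed = λ _ _ (_ , ¬lr) Y⊆X Y≢[] → Y≢[] , λ (l , r) → ¬lr (Y⊆X l , Y⊆X r)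
    ; singletons = path-singleton ; χ = path-colour
    ; χ-inj = λ _ _ _ _ → path-colour-injective
    ; lab = λ _ _ _ → ⊥ ; lab-local = λ _ _ _ () }

  ab-facet : Facet path (left ∷ middle ∷ [])
  ab-facet = ((λ ()) , λ { (_ , there (there ())) })
           , λ where
               _ _          _   {left}   _   → here refl
               _ _          _   {middle} _   → there (here refl)
               _ (_ , ¬lr) X⊆Y {right}  r∈Y → ⊥-elim (¬lr (X⊆Y (here refl) , r∈Y))

  bc-facet : Facet path (middle ∷ right ∷ [])
  bc-facet = ((λ ()) , λ { (there (there ()) , _) })
           , λ where
               _ (_ , ¬lr) X⊆Y {left}   l∈Y → ⊥-elim (¬lr (l∈Y , X⊆Y (there (here refl))))
               _ _          _   {middle} _   → here refl
               _ _          _   {right}  _   → there (here refl)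

  facet-at-left : ∀ {Y} → Facet path Y → left ∈ Y → middle ∈ Y × ¬ right ∈ Y
  facet-at-left {Y} ((_ , ¬lr) , maximal) l∈Y =
    maximal (middle ∷ Y) ((λ ()) , ¬lr′) there (here refl) , λ r∈Y → ¬lr (l∈Y , r∈Y)
    where
    ¬lr′ : ¬ (left ∈ middle ∷ Y × right ∈ middle ∷ Y)
    ¬lr′ (here () , _)
    ¬lr′ (there _ , here ())
    ¬lr′ (there l∈Y′ , there r∈Y′) = ¬lr (l∈Y′ , r∈Y′)

  _∼_ : List EdgeVertex → List PathVertex → Set
  Z ∼ W = Facet edge Z × Facet path W × left ∈ W

  ∼-colours : ∀ {Z W} → Z ∼ W → ∀ x → _∈χ_ edge x Z ⇔ _∈χ_ path x W
  ∼-colours {Z} {W} (fZ , fW , l∈W) x = mk⇔ to from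
    where
    to : _∈χ_ edge x Z → _∈χ_ path x W
    to (left   , _ , a≡x) = left , l∈W , a≡x
    to (middle , _ , b≡x) = middle , proj₁ (facet-at-left fW l∈W) , b≡x
    from : _∈χ_ path x W → _∈χ_ edge x Z
    from (left   , _ , a≡x) = left , Edge.facet⇒complete fZ left , a≡x
    from (middle , _ , b≡x) = middle , Edge.facet⇒complete fZ middle , b≡x
    from (right  , r∈W , _) = ⊥-elim (proj₂ (facet-at-left fW l∈W) r∈W)

  edge≈path : Bisimulation a edge path
  edge≈path = record
    { _∼_     = _∼_
    ; colours = ∼-colours
    ; labels  = λ _ _ _ → mk⇔ (λ { (_ , _ , ()) }) (λ { (_ , _ , ()) })
    ; forth   = λ (_ , _ , l∈W) fY _ →
                  _ , ab-facet , (left , l∈W , here refl , refl) , fY , ab-facet , here refl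
    ; back    = back
    }
    where
    back : ∀ {Z W Y′} → Z ∼ W → Facet path Y′ → _∈χ∩_,_ path a W Y′ → Possibly edge a Z (_∼ Y′)
    back (fZ , _ , _) fY′ (v , _ , v∈Y′ , v≡a) with path-colour-injective v≡a
    ... | refl = _ , edge-facet , (left , Edge.facet⇒complete fZ left , here refl , refl)
               , edge-facet , fY′ , v∈Y′

  ab-facet-defines-K-b-c : ∀ {p} → Def path (left ∷ middle ∷ []) (K b (atom c p))
  ab-facet-defines-K-b-c =
    _ , bc-facet , (middle , there (here refl) , here refl , refl) , (right , there (here refl) , refl)

proposition4p3 : {n : ℕ} (L : Fin n → Set) → (∀ a → Countable (L a))
    → (a b c : Fin n) → a ≢ b → a ≢ c → b ≢ c
    → (pa : L a) (pc : L c)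
    → ¬ (Σ (Form L) λ ψ → (M : Model L) (X : List (Model.V M)) → Facet M X
          → ((¬ Def M X (and (atom a pa) (K b (atom c pc))) → Sat M X ψ)
             × (Sat M X ψ → ¬ Def M X (and (atom a pa) (K b (atom c pc))))))
proposition4p3 L _ a b c a≢b a≢c b≢c pa pc (ψ , ψ-characterises) =
  proj₂ (ψ-characterises path _ ab-facet) ψ-at-path φ-defined-at-path
  where
  open Counterexample {L = L} a≢b a≢c b≢c

  ψ-onlyKhat : OnlyKhat a ψ
  ψ-onlyKhat = def⇒onlyKhat point (λ _ → refl) _ ψ (sat⇒def point _ ψ ψ-at-point)
    where
    ψ-at-point : Sat point (tt ∷ []) ψ
    ψ-at-point = proj₁ (ψ-characterises point _ point-facet) λ (_ , dK) → point-lacks-b {atom c pc} dK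

  ψ-at-edge : Sat edge (left ∷ middle ∷ []) ψ
  ψ-at-edge = proj₁ (ψ-characterises edge _ edge-facet) λ (_ , _ , _ , _ , c∈Y) → edge-lacks-c c∈Y

  ψ-at-path : Sat path (left ∷ middle ∷ []) ψ
  ψ-at-path = Equivalence.to (sat-invariant edge≈path ψ ψ-onlyKhat (edge-facet , ab-facet , here refl))
                             ψ-at-edge

  φ-defined-at-path : Def path (left ∷ middle ∷ []) (and (atom a pa) (K b (atom c pc)))
  φ-defined-at-path = (left , here refl , refl) , ab-facet-defines-K-b-c {pc}
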